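{- Let $N$ be a positive integer and $p$ a prime. Let $c_1, c_2, c_3$ be positive integers with $c_1 = \min_i c_i$, and set $C = c_1^3 + c_2^3 + c_3^3$. Let $\beta \geq 1$ be such that $$2C + 216\beta^3 < \frac{N}{p^3} < 2C + 6c_1^3.$$ Suppose $x_0$ is a positive integer with $x_0 \leq 6\beta p$, and define $Q_0$ by $N - x_0^3 = 2Cp^3 + 6pQ_0$. Then $Q_0 > 0$. If moreover $Q_0 = c_1 X_1^2 + c_2 X_2^2 + c_3 X_3^2$ for some integers $X_1, X_2, X_3$, then $N$ is the sum of the cubes of seven positive integers.
   Formalization: The parameter β ≥ 1 ranges over the rationals. -}

module Defs where

open import Data.Nat using (ℕ)
open import Data.Integer using (ℤ; +_)
open import Data.Rational using (ℚ; _/_; _*_)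

ℕtoℚ : ℕ → ℚ
ℕtoℚ n = (+ n) / 1

ℤtoℚ : ℤ → ℚ
ℤtoℚ z = z / 1

cubeℚ : ℚ → ℚ
cubeℚ q = q * q * q

module Submission where

-- The argument rests on the identity  (m + a)³ + (m − a)³ = 2m³ + 6ma².
-- Writing N − x₀³ = 2Cp³ + 6pQ₀ with Q₀ = Σ cᵢXᵢ² and aᵢ = |Xᵢ|, the
-- right-hand side splits as Σᵢ (2(cᵢp)³ + 6(cᵢp)aᵢ²), and each summand is
-- (cᵢp + aᵢ)³ + (cᵢp − aᵢ)³, a sum of two positive cubes once aᵢ < cᵢp.

open import Defs
open import Data.Nat using (ℕ; _≤_; _<_; _^_; _+_; _*_)
open import Data.Nat.Primality using (Prime)
open import Data.Integer using (ℤ)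
open import Data.Rational using (ℚ; 1ℚ; 0ℚ) renaming (_+_ to _+ℚ_; _*_ to _*ℚ_; _-_ to _-ℚ_; _≤_ to _≤ℚ_; _<_ to _<ℚ_)
open import Data.Product using (_×_; ∃-syntax)
open import Relation.Binary.PropositionalEquality using (_≡_)

open import Data.Nat using (suc; z<s)
import Data.Nat.Properties as ℕ
open import Data.Nat.Solver using (module +-*-Solver)
open import Data.Nat.Coprimality using (1-coprimeTo)
import Data.Nat.Coprimality as Coprime
open import Data.Integer as ℤ using (+_; -[1+_])
import Data.Integer.Properties as ℤ
open import Data.Rational as ℚ using (mkℚ)
import Data.Rational.Properties as ℚ
import Data.Rational.Solver as ℚ-Solver
open import Data.Product using (_,_)
open import Relation.Binary.PropositionalEquality using (refl; sym; trans; cong; cong₂; subst; module ≡-Reasoning)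

ℤtoℚ-mkℚ : ∀ z → ℤtoℚ z ≡ mkℚ z 0 (Coprime.sym (1-coprimeTo ℤ.∣ z ∣))
ℤtoℚ-mkℚ (+ n)    = ℚ.normalize-coprime (Coprime.sym (1-coprimeTo n))
ℤtoℚ-mkℚ -[1+ n ] = cong ℚ.-_ (ℚ.normalize-coprime (Coprime.sym (1-coprimeTo (suc n))))

ℤtoℚ-+ : ∀ a b → ℤtoℚ (a ℤ.+ b) ≡ ℤtoℚ a +ℚ ℤtoℚ b
ℤtoℚ-+ a b rewrite ℤtoℚ-mkℚ a | ℤtoℚ-mkℚ b =
  cong (λ z → z ℚ./ 1) (cong₂ ℤ._+_ (sym (ℤ.*-identityʳ a)) (sym (ℤ.*-identityʳ b)))

ℤtoℚ-* : ∀ a b → ℤtoℚ (a ℤ.* b) ≡ ℤtoℚ a *ℚ ℤtoℚ b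
ℤtoℚ-* a b rewrite ℤtoℚ-mkℚ a | ℤtoℚ-mkℚ b = refl

ℤtoℚ-injective : ∀ {a b} → ℤtoℚ a ≡ ℤtoℚ b → a ≡ b
ℤtoℚ-injective {a} {b} eq = cong ℚ.↥_ (trans (sym (ℤtoℚ-mkℚ a)) (trans eq (ℤtoℚ-mkℚ b)))

-- ℕtoℚ n is definitionally ℤtoℚ (+ n), so its properties follow from those above.
ℕtoℚ-+ : ∀ m n → ℕtoℚ (m + n) ≡ ℕtoℚ m +ℚ ℕtoℚ n
ℕtoℚ-+ m n = trans (cong ℤtoℚ (ℤ.pos-+ m n)) (ℤtoℚ-+ (+ m) (+ n))

ℕtoℚ-* : ∀ m n → ℕtoℚ (m * n) ≡ ℕtoℚ m *ℚ ℕtoℚ n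
ℕtoℚ-* m n = trans (cong ℤtoℚ (ℤ.pos-* m n)) (ℤtoℚ-* (+ m) (+ n))

ℕtoℚ-injective : ∀ {m n} → ℕtoℚ m ≡ ℕtoℚ n → m ≡ n
ℕtoℚ-injective eq = ℤ.+-injective (ℤtoℚ-injective eq)

ℕtoℚ-nonNeg : ∀ n → 0ℚ ≤ℚ ℕtoℚ n
ℕtoℚ-nonNeg n = ℚ.nonNegative⁻¹ (ℕtoℚ n) {{ℚ.normalize-nonNeg n 1}}

ℕtoℚ-cube : ∀ m → ℕtoℚ (m ^ 3) ≡ cubeℚ (ℕtoℚ m)
ℕtoℚ-cube m = begin
  ℕtoℚ (m * (m * (m * 1)))       ≡⟨ ℕtoℚ-* m _ ⟩
  q *ℚ ℕtoℚ (m * (m * 1))        ≡⟨ cong (q *ℚ_) (ℕtoℚ-* m _) ⟩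
  q *ℚ (q *ℚ ℕtoℚ (m * 1))       ≡⟨ cong (λ t → q *ℚ (q *ℚ t)) (ℕtoℚ-* m 1) ⟩
  q *ℚ (q *ℚ (q *ℚ 1ℚ))          ≡⟨ solve 1 (λ x → x :* (x :* (x :* con 1ℚ)) := x :* x :* x) refl q ⟩
  cubeℚ q                        ∎
  where
  open ≡-Reasoning
  open ℚ-Solver.+-*-Solver
  q : ℚ
  q = ℕtoℚ m

ℕtoℚ-weighted-square : ∀ c X → ℕtoℚ c *ℚ ℤtoℚ X *ℚ ℤtoℚ X ≡ ℕtoℚ (c * (ℤ.∣ X ∣ * ℤ.∣ X ∣))
ℕtoℚ-weighted-square c X = begin
  ℕtoℚ c *ℚ ℤtoℚ X *ℚ ℤtoℚ X    ≡⟨ ℚ.*-assoc (ℕtoℚ c) (ℤtoℚ X) (ℤtoℚ X) ⟩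
  ℕtoℚ c *ℚ (ℤtoℚ X *ℚ ℤtoℚ X)  ≡⟨ cong (ℕtoℚ c *ℚ_) (sym (ℤtoℚ-* X X)) ⟩
  ℕtoℚ c *ℚ ℤtoℚ (X ℤ.* X)      ≡⟨ cong (λ z → ℕtoℚ c *ℚ ℤtoℚ z) (square-abs X) ⟩
  ℕtoℚ c *ℚ ℕtoℚ (a * a)        ≡⟨ sym (ℕtoℚ-* c (a * a)) ⟩
  ℕtoℚ (c * (a * a))            ∎
  where
  open ≡-Reasoning
  a : ℕ
  a = ℤ.∣ X ∣
  square-abs : ∀ Y → Y ℤ.* Y ≡ + (ℤ.∣ Y ∣ * ℤ.∣ Y ∣)
  square-abs (+ n)    = sym (ℤ.pos-* n n)
  square-abs -[1+ n ] = refl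

*-mono-≤-nonNeg : ∀ {a b c d} → 0ℚ ≤ℚ a → a ≤ℚ b → 0ℚ ≤ℚ c → c ≤ℚ d → a *ℚ c ≤ℚ b *ℚ d
*-mono-≤-nonNeg {a} {b} {c} {d} 0≤a a≤b 0≤c c≤d =
  ℚ.≤-trans (ℚ.*-monoˡ-≤-nonNeg a {{ℚ.nonNegative 0≤a}} c≤d)
            (ℚ.*-monoʳ-≤-nonNeg d {{ℚ.nonNegative (ℚ.≤-trans 0≤c c≤d)}} a≤b)

cube-mono-≤ : ∀ {a b} → 0ℚ ≤ℚ a → a ≤ℚ b → cubeℚ a ≤ℚ cubeℚ b
cube-mono-≤ {a} 0≤a a≤b =
  *-mono-≤-nonNeg 0≤a² (*-mono-≤-nonNeg 0≤a a≤b 0≤a a≤b) 0≤a a≤b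
  where
  0≤a² : 0ℚ ≤ℚ a *ℚ a
  0≤a² = *-mono-≤-nonNeg ℚ.≤-refl 0≤a ℚ.≤-refl 0≤a

remainder-positive : ∀ n x a s r → 0ℚ ≤ℚ s → n -ℚ x ≡ a +ℚ s *ℚ r → a +ℚ x <ℚ n → 0ℚ <ℚ r
remainder-positive n x a s r 0≤s eq a+x<n =
  ℚ.*-cancelˡ-<-nonNeg s {{ℚ.nonNegative 0≤s}} (begin-strict
    s *ℚ 0ℚ                   ≡⟨ ℚ.*-zeroʳ s ⟩
    0ℚ                        ≡⟨ sym (ℚ.+-inverseʳ (a +ℚ x)) ⟩
    (a +ℚ x) -ℚ (a +ℚ x)      <⟨ ℚ.+-monoˡ-< (ℚ.- (a +ℚ x)) a+x<n ⟩
    n -ℚ (a +ℚ x)             ≡⟨ solve 3 (λ n x a → n :- (a :+ x) := (n :- x) :- a) refl n x a ⟩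
    (n -ℚ x) -ℚ a             ≡⟨ cong (_-ℚ a) eq ⟩
    (a +ℚ s *ℚ r) -ℚ a        ≡⟨ solve 2 (λ a t → (a :+ t) :- a := t) refl a (s *ℚ r) ⟩
    s *ℚ r                    ∎)
  where
  open ℚ.≤-Reasoning
  open ℚ-Solver.+-*-Solver

cube-bound : ∀ x p (β : ℚ) → ℕtoℚ x ≤ℚ ℕtoℚ 6 *ℚ β *ℚ ℕtoℚ p →
  ℕtoℚ (x ^ 3) ≤ℚ ℕtoℚ 216 *ℚ cubeℚ β *ℚ ℕtoℚ (p ^ 3)
cube-bound x p β x≤6βp = begin
  ℕtoℚ (x ^ 3)                                 ≡⟨ ℕtoℚ-cube x ⟩
  cubeℚ (ℕtoℚ x)                               ≤⟨ cube-mono-≤ (ℕtoℚ-nonNeg x) x≤6βp ⟩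
  cubeℚ (ℕtoℚ 6 *ℚ β *ℚ ℕtoℚ p)                ≡⟨ cube-distrib (ℕtoℚ 6) β (ℕtoℚ p) ⟩
  cubeℚ (ℕtoℚ 6) *ℚ cubeℚ β *ℚ cubeℚ (ℕtoℚ p)  ≡⟨ cong₂ (λ u v → u *ℚ cubeℚ β *ℚ v) (sym (ℕtoℚ-cube 6)) (sym (ℕtoℚ-cube p)) ⟩
  ℕtoℚ 216 *ℚ cubeℚ β *ℚ ℕtoℚ (p ^ 3)          ∎
  where
  open ℚ.≤-Reasoning
  open ℚ-Solver.+-*-Solver
  cube-distrib : ∀ u v w → cubeℚ (u *ℚ v *ℚ w) ≡ cubeℚ u *ℚ cubeℚ v *ℚ cubeℚ w
  cube-distrib = solve 3 (λ u v w → (u :* v :* w) :* (u :* v :* w) :* (u :* v :* w)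
                                   := (u :* u :* u) :* (v :* v :* v) :* (w :* w :* w)) refl

Q₀-positive : (N p C x₀ : ℕ) (β Q₀ : ℚ) →
  (ℕtoℚ 2 *ℚ ℕtoℚ C +ℚ ℕtoℚ 216 *ℚ cubeℚ β) *ℚ ℕtoℚ (p ^ 3) <ℚ ℕtoℚ N →
  ℕtoℚ x₀ ≤ℚ ℕtoℚ 6 *ℚ β *ℚ ℕtoℚ p →
  ℕtoℚ N -ℚ ℕtoℚ (x₀ ^ 3) ≡ ℕtoℚ (2 * C * p ^ 3) +ℚ ℕtoℚ (6 * p) *ℚ Q₀ →
  0ℚ <ℚ Q₀
Q₀-positive N p C x₀ β Q₀ lower x₀≤6βp defQ₀ =
  remainder-positive (ℕtoℚ N) (ℕtoℚ (x₀ ^ 3)) (ℕtoℚ (2 * C * p ^ 3)) (ℕtoℚ (6 * p)) Q₀ (ℕtoℚ-nonNeg (6 * p)) defQ₀ (begin-strict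
    ℕtoℚ (2 * C * p ^ 3) +ℚ ℕtoℚ (x₀ ^ 3)  ≤⟨ ℚ.+-monoʳ-≤ (ℕtoℚ (2 * C * p ^ 3)) (cube-bound x₀ p β x₀≤6βp) ⟩
    ℕtoℚ (2 * C * p ^ 3) +ℚ T              ≡⟨ cong (_+ℚ T) (trans (ℕtoℚ-* (2 * C) (p ^ 3)) (cong (_*ℚ ℕtoℚ (p ^ 3)) (ℕtoℚ-* 2 C))) ⟩
    ℕtoℚ 2 *ℚ ℕtoℚ C *ℚ P +ℚ T             ≡⟨ distrib (ℕtoℚ 2) (ℕtoℚ C) (ℕtoℚ 216 *ℚ cubeℚ β) P ⟩
    (ℕtoℚ 2 *ℚ ℕtoℚ C +ℚ ℕtoℚ 216 *ℚ cubeℚ β) *ℚ P  <⟨ lower ⟩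
    ℕtoℚ N                                 ∎)
  where
  open ℚ.≤-Reasoning
  open ℚ-Solver.+-*-Solver
  P : ℚ
  P = ℕtoℚ (p ^ 3)
  T : ℚ
  T = ℕtoℚ 216 *ℚ cubeℚ β *ℚ P
  distrib : ∀ u c t q → u *ℚ c *ℚ q +ℚ t *ℚ q ≡ (u *ℚ c +ℚ t) *ℚ q
  distrib = solve 4 (λ u c t q → u :* c :* q :+ t :* q := (u :* c :+ t) :* q) refl

TwoPositiveCubes : ℕ → Set
TwoPositiveCubes n = ∃[ u ] ∃[ v ] (0 < u × 0 < v × n ≡ u ^ 3 + v ^ 3)

-- (m + a)³ + (m − a)³ = 2m³ + 6ma², written with m = a + (1 + o) to stay in ℕ.
twin-cubes-identity : ∀ a o →
  2 * (suc a + o) ^ 3 + 6 * (suc a + o) * (a * a) ≡ (suc a + o + a) ^ 3 + suc o ^ 3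
twin-cubes-identity = solve 2 (λ a o →
  con 2 :* (con 1 :+ a :+ o) :^ 3 :+ con 6 :* (con 1 :+ a :+ o) :* (a :* a)
  := (con 1 :+ a :+ o :+ a) :^ 3 :+ (con 1 :+ o) :^ 3) refl
  where open +-*-Solver

twin-cubes : ∀ {a m} → a < m → TwoPositiveCubes (2 * m ^ 3 + 6 * m * (a * a))
twin-cubes {a} a<m with ℕ.m≤n⇒∃[o]m+o≡n a<m
... | o , refl = suc (a + o + a) , suc o , z<s , z<s , twin-cubes-identity a o

-- The summand of index i: if c·a² < c³p², i.e. a < cp, then
-- 2c³p³ + 6p·ca² = 2(cp)³ + 6(cp)a² is a sum of two positive cubes.
weighted-twin-cubes : ∀ c p a → c * (a * a) < c ^ 3 * (p * p) →
  TwoPositiveCubes (2 * c ^ 3 * p ^ 3 + 6 * p * (c * (a * a)))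
weighted-twin-cubes c p a ca²<c³p² =
  subst TwoPositiveCubes (rescale c p a) (twin-cubes a<cp)
  where
  open +-*-Solver
  rescale : ∀ c p a → 2 * (c * p) ^ 3 + 6 * (c * p) * (a * a) ≡ 2 * c ^ 3 * p ^ 3 + 6 * p * (c * (a * a))
  rescale = solve 3 (λ c p a →
    con 2 :* (c :* p) :^ 3 :+ con 6 :* (c :* p) :* (a :* a)
    := con 2 :* c :^ 3 :* p :^ 3 :+ con 6 :* p :* (c :* (a :* a))) refl
  c³p²≡c[cp]² : c ^ 3 * (p * p) ≡ c * ((c * p) * (c * p))
  c³p²≡c[cp]² = solve 2 (λ c p → c :^ 3 :* (p :* p) := c :* ((c :* p) :* (c :* p))) refl c p
  a<cp : a < c * p
  a<cp = ℕ.≰⇒> (λ cp≤a → ℕ.<⇒≱ (ℕ.*-cancelˡ-< c _ _ (subst (c * (a * a) <_) c³p²≡c[cp]² ca²<c³p²))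
                                  (ℕ.*-mono-≤ cp≤a cp≤a))

diagonalForm : (c₁ c₂ c₃ a₁ a₂ a₃ : ℕ) → ℕ
diagonalForm c₁ c₂ c₃ a₁ a₂ a₃ = c₁ * (a₁ * a₁) + c₂ * (a₂ * a₂) + c₃ * (a₃ * a₃)

SevenPositiveCubes : ℕ → Set
SevenPositiveCubes N = ∃[ y₁ ] ∃[ y₂ ] ∃[ y₃ ] ∃[ y₄ ] ∃[ y₅ ] ∃[ y₆ ] ∃[ y₇ ]
  (0 < y₁ × 0 < y₂ × 0 < y₃ × 0 < y₄ × 0 < y₅ × 0 < y₆ × 0 < y₇
   × N ≡ y₁ ^ 3 + y₂ ^ 3 + y₃ ^ 3 + y₄ ^ 3 + y₅ ^ 3 + y₆ ^ 3 + y₇ ^ 3)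

assemble : ∀ {x s t r} → 0 < x → TwoPositiveCubes s → TwoPositiveCubes t → TwoPositiveCubes r →
  SevenPositiveCubes (x ^ 3 + s + t + r)
assemble {x} 0<x (u₁ , v₁ , 0<u₁ , 0<v₁ , refl) (u₂ , v₂ , 0<u₂ , 0<v₂ , refl) (u₃ , v₃ , 0<u₃ , 0<v₃ , refl) =
  x , u₁ , v₁ , u₂ , v₂ , u₃ , v₃ , 0<x , 0<u₁ , 0<v₁ , 0<u₂ , 0<v₂ , 0<u₃ , 0<v₃ ,
  solve 7 (λ x u₁ v₁ u₂ v₂ u₃ v₃ → x :+ (u₁ :+ v₁) :+ (u₂ :+ v₂) :+ (u₃ :+ v₃)
                                   := x :+ u₁ :+ v₁ :+ u₂ :+ v₂ :+ u₃ :+ v₃)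
        refl (x ^ 3) (u₁ ^ 3) (v₁ ^ 3) (u₂ ^ 3) (v₂ ^ 3) (u₃ ^ 3) (v₃ ^ 3)
  where open +-*-Solver

seven-cubes : ∀ x p c₁ c₂ c₃ a₁ a₂ a₃ → 0 < x → c₁ ≤ c₂ → c₁ ≤ c₃ →
  diagonalForm c₁ c₂ c₃ a₁ a₂ a₃ < c₁ ^ 3 * (p * p) →
  SevenPositiveCubes (x ^ 3 + 2 * (c₁ ^ 3 + c₂ ^ 3 + c₃ ^ 3) * p ^ 3 + 6 * p * diagonalForm c₁ c₂ c₃ a₁ a₂ a₃)
seven-cubes x p c₁ c₂ c₃ a₁ a₂ a₃ 0<x c₁≤c₂ c₁≤c₃ k<c₁³p² =
  subst SevenPositiveCubes (sym regroup)
    (assemble 0<x (weighted-twin-cubes c₁ p a₁ (below c₁ a₁ ℕ.≤-refl (ℕ.≤-trans (ℕ.m≤m+n t₁ t₂) (ℕ.m≤m+n (t₁ + t₂) t₃))))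
                  (weighted-twin-cubes c₂ p a₂ (below c₂ a₂ c₁≤c₂ (ℕ.≤-trans (ℕ.m≤n+m t₂ t₁) (ℕ.m≤m+n (t₁ + t₂) t₃))))
                  (weighted-twin-cubes c₃ p a₃ (below c₃ a₃ c₁≤c₃ (ℕ.m≤n+m t₃ (t₁ + t₂)))))
  where
  open +-*-Solver
  t₁ : ℕ
  t₁ = c₁ * (a₁ * a₁)
  t₂ : ℕ
  t₂ = c₂ * (a₂ * a₂)
  t₃ : ℕ
  t₃ = c₃ * (a₃ * a₃)
  k : ℕ
  k = diagonalForm c₁ c₂ c₃ a₁ a₂ a₃
  below : ∀ c a → c₁ ≤ c → c * (a * a) ≤ k → c * (a * a) < c ^ 3 * (p * p)
  below c a c₁≤c ca²≤k = ℕ.<-≤-trans (ℕ.≤-<-trans ca²≤k k<c₁³p²) (ℕ.*-monoˡ-≤ (p * p) (ℕ.^-monoˡ-≤ 3 c₁≤c))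
  regroup : x ^ 3 + 2 * (c₁ ^ 3 + c₂ ^ 3 + c₃ ^ 3) * p ^ 3 + 6 * p * k
          ≡ x ^ 3 + (2 * c₁ ^ 3 * p ^ 3 + 6 * p * (c₁ * (a₁ * a₁)))
                  + (2 * c₂ ^ 3 * p ^ 3 + 6 * p * (c₂ * (a₂ * a₂)))
                  + (2 * c₃ ^ 3 * p ^ 3 + 6 * p * (c₃ * (a₃ * a₃)))
  regroup = solve 8 (λ x p c₁ c₂ c₃ a₁ a₂ a₃ →
    x :^ 3 :+ con 2 :* (c₁ :^ 3 :+ c₂ :^ 3 :+ c₃ :^ 3) :* p :^ 3
      :+ con 6 :* p :* (c₁ :* (a₁ :* a₁) :+ c₂ :* (a₂ :* a₂) :+ c₃ :* (a₃ :* a₃))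
    := x :^ 3 :+ (con 2 :* c₁ :^ 3 :* p :^ 3 :+ con 6 :* p :* (c₁ :* (a₁ :* a₁)))
              :+ (con 2 :* c₂ :^ 3 :* p :^ 3 :+ con 6 :* p :* (c₂ :* (a₂ :* a₂)))
              :+ (con 2 :* c₃ :^ 3 :* p :^ 3 :+ con 6 :* p :* (c₃ :* (a₃ :* a₃))))
    refl x p c₁ c₂ c₃ a₁ a₂ a₃

quadratic-part-bound : ∀ y B c p k → y + B * p ^ 3 + 6 * p * k < (B + 6 * c ^ 3) * p ^ 3 → k < c ^ 3 * (p * p)
quadratic-part-bound y B c p k upper =
  ℕ.*-cancelˡ-< (6 * p) _ _ (ℕ.+-cancelˡ-< (B * p ^ 3) _ _ (begin-strict
    B * p ^ 3 + 6 * p * k              ≤⟨ ℕ.m≤n+m _ y ⟩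
    y + (B * p ^ 3 + 6 * p * k)        ≡⟨ ℕ.+-assoc y _ _ ⟨
    y + B * p ^ 3 + 6 * p * k          <⟨ upper ⟩
    (B + 6 * c ^ 3) * p ^ 3            ≡⟨ expand B c p ⟩
    B * p ^ 3 + 6 * p * (c ^ 3 * (p * p)) ∎))
  where
  open ℕ.≤-Reasoning
  open +-*-Solver
  expand : ∀ B c p → (B + 6 * c ^ 3) * p ^ 3 ≡ B * p ^ 3 + 6 * p * (c ^ 3 * (p * p))
  expand = solve 3 (λ B c p → (B :+ con 6 :* c :^ 3) :* p :^ 3 := B :* p :^ 3 :+ con 6 :* p :* (c :^ 3 :* (p :* p))) refl

RepresentedBy : (c₁ c₂ c₃ : ℕ) → ℚ → Set
RepresentedBy c₁ c₂ c₃ Q = ∃[ X₁ ] ∃[ X₂ ] ∃[ X₃ ]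
  (Q ≡ ℕtoℚ c₁ *ℚ ℤtoℚ X₁ *ℚ ℤtoℚ X₁ +ℚ ℕtoℚ c₂ *ℚ ℤtoℚ X₂ *ℚ ℤtoℚ X₂ +ℚ ℕtoℚ c₃ *ℚ ℤtoℚ X₃ *ℚ ℤtoℚ X₃)

diagonalForm-value : ∀ c₁ c₂ c₃ X₁ X₂ X₃ →
  ℕtoℚ c₁ *ℚ ℤtoℚ X₁ *ℚ ℤtoℚ X₁ +ℚ ℕtoℚ c₂ *ℚ ℤtoℚ X₂ *ℚ ℤtoℚ X₂ +ℚ ℕtoℚ c₃ *ℚ ℤtoℚ X₃ *ℚ ℤtoℚ X₃
  ≡ ℕtoℚ (diagonalForm c₁ c₂ c₃ ℤ.∣ X₁ ∣ ℤ.∣ X₂ ∣ ℤ.∣ X₃ ∣)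
diagonalForm-value c₁ c₂ c₃ X₁ X₂ X₃ =
  trans (cong₂ _+ℚ_ (cong₂ _+ℚ_ (ℕtoℚ-weighted-square c₁ X₁) (ℕtoℚ-weighted-square c₂ X₂))
                    (ℕtoℚ-weighted-square c₃ X₃))
        (sym (trans (ℕtoℚ-+ (t₁ + t₂) t₃) (cong (_+ℚ ℕtoℚ t₃) (ℕtoℚ-+ t₁ t₂))))
  where
  t₁ : ℕ
  t₁ = c₁ * (ℤ.∣ X₁ ∣ * ℤ.∣ X₁ ∣)
  t₂ : ℕ
  t₂ = c₂ * (ℤ.∣ X₂ ∣ * ℤ.∣ X₂ ∣)
  t₃ : ℕ
  t₃ = c₃ * (ℤ.∣ X₃ ∣ * ℤ.∣ X₃ ∣)

integral-equation : ∀ N x A s k → ℕtoℚ N -ℚ ℕtoℚ x ≡ ℕtoℚ A +ℚ ℕtoℚ s *ℚ ℕtoℚ k → N ≡ x + A + s * k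
integral-equation N x A s k eq = ℕtoℚ-injective (begin
  ℕtoℚ N                                         ≡⟨ solve 2 (λ n x → n := (n :- x) :+ x) refl (ℕtoℚ N) (ℕtoℚ x) ⟩
  (ℕtoℚ N -ℚ ℕtoℚ x) +ℚ ℕtoℚ x                   ≡⟨ cong (_+ℚ ℕtoℚ x) eq ⟩
  (ℕtoℚ A +ℚ ℕtoℚ s *ℚ ℕtoℚ k) +ℚ ℕtoℚ x         ≡⟨ solve 3 (λ a t x → (a :+ t) :+ x := x :+ a :+ t) refl (ℕtoℚ A) (ℕtoℚ s *ℚ ℕtoℚ k) (ℕtoℚ x) ⟩
  ℕtoℚ x +ℚ ℕtoℚ A +ℚ ℕtoℚ s *ℚ ℕtoℚ k           ≡⟨ cong₂ _+ℚ_ (ℕtoℚ-+ x A) (ℕtoℚ-* s k) ⟨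
  ℕtoℚ (x + A) +ℚ ℕtoℚ (s * k)                   ≡⟨ ℕtoℚ-+ (x + A) (s * k) ⟨
  ℕtoℚ (x + A + s * k)                           ∎)
  where
  open ≡-Reasoning
  open ℚ-Solver.+-*-Solver

proposition1 : (N p c₁ c₂ c₃ x₀ : ℕ) → (β Q₀ : ℚ) →
    0 < N → Prime p →
    0 < c₁ → 0 < c₂ → 0 < c₃ → c₁ ≤ c₂ → c₁ ≤ c₃ →
    1ℚ ≤ℚ β →
    (ℕtoℚ 2 *ℚ ℕtoℚ (c₁ ^ 3 + c₂ ^ 3 + c₃ ^ 3) +ℚ ℕtoℚ 216 *ℚ cubeℚ β) *ℚ ℕtoℚ (p ^ 3) <ℚ ℕtoℚ N →
    N < (2 * (c₁ ^ 3 + c₂ ^ 3 + c₃ ^ 3) + 6 * c₁ ^ 3) * p ^ 3 →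
    0 < x₀ → ℕtoℚ x₀ ≤ℚ ℕtoℚ 6 *ℚ β *ℚ ℕtoℚ p →
    ℕtoℚ N -ℚ ℕtoℚ (x₀ ^ 3) ≡ ℕtoℚ (2 * (c₁ ^ 3 + c₂ ^ 3 + c₃ ^ 3) * p ^ 3) +ℚ ℕtoℚ (6 * p) *ℚ Q₀ →
    (0ℚ <ℚ Q₀)
    × ((∃[ X₁ ] ∃[ X₂ ] ∃[ X₃ ]
          (Q₀ ≡ ℕtoℚ c₁ *ℚ ℤtoℚ X₁ *ℚ ℤtoℚ X₁ +ℚ ℕtoℚ c₂ *ℚ ℤtoℚ X₂ *ℚ ℤtoℚ X₂ +ℚ ℕtoℚ c₃ *ℚ ℤtoℚ X₃ *ℚ ℤtoℚ X₃))
       → ∃[ y₁ ] ∃[ y₂ ] ∃[ y₃ ] ∃[ y₄ ] ∃[ y₅ ] ∃[ y₆ ] ∃[ y₇ ]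
           (0 < y₁ × 0 < y₂ × 0 < y₃ × 0 < y₄ × 0 < y₅ × 0 < y₆ × 0 < y₇
            × N ≡ y₁ ^ 3 + y₂ ^ 3 + y₃ ^ 3 + y₄ ^ 3 + y₅ ^ 3 + y₆ ^ 3 + y₇ ^ 3))
proposition1 N p c₁ c₂ c₃ x₀ β Q₀ _ _ _ _ _ c₁≤c₂ c₁≤c₃ _ lower upper 0<x₀ x₀≤6βp defQ₀ =
  Q₀-positive N p C x₀ β Q₀ lower x₀≤6βp defQ₀ , seven
  where
  C : ℕ
  C = c₁ ^ 3 + c₂ ^ 3 + c₃ ^ 3
  seven : RepresentedBy c₁ c₂ c₃ Q₀ → SevenPositiveCubes N
  seven (X₁ , X₂ , X₃ , Q₀≡form) =
    subst SevenPositiveCubes (sym N≡) (seven-cubes x₀ p c₁ c₂ c₃ a₁ a₂ a₃ 0<x₀ c₁≤c₂ c₁≤c₃ k<c₁³p²)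
    where
    a₁ : ℕ
    a₁ = ℤ.∣ X₁ ∣
    a₂ : ℕ
    a₂ = ℤ.∣ X₂ ∣
    a₃ : ℕ
    a₃ = ℤ.∣ X₃ ∣
    k : ℕ
    k = diagonalForm c₁ c₂ c₃ a₁ a₂ a₃
    N≡ : N ≡ x₀ ^ 3 + 2 * C * p ^ 3 + 6 * p * k
    N≡ = integral-equation N (x₀ ^ 3) (2 * C * p ^ 3) (6 * p) k
           (subst (λ q → ℕtoℚ N -ℚ ℕtoℚ (x₀ ^ 3) ≡ ℕtoℚ (2 * C * p ^ 3) +ℚ ℕtoℚ (6 * p) *ℚ q)
                  (trans Q₀≡form (diagonalForm-value c₁ c₂ c₃ X₁ X₂ X₃)) defQ₀)
    k<c₁³p² : k < c₁ ^ 3 * (p * p)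
    k<c₁³p² = quadratic-part-bound (x₀ ^ 3) (2 * C) c₁ p k (subst (_< _) N≡ upper)
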